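{- Let $H$ be a connected graph whose vertex set can be partitioned into a stable set $S$ and a set $X$ such that: (a) every $x\in X$ has a neighbour in $S$; (b) for any $x_1,x_2\in X$, $x_1$ is adjacent to $x_2$ if and only if $N(x_1)\cap S\subseteq N(x_2)\cap S$ or $N(x_2)\cap S\subseteq N(x_1)\cap S$; (c) for any $x_1,x_2\in X$, $x_1$ is non-adjacent to $x_2$ if and only if $N(x_1)\cap S$ and $N(x_2)\cap S$ are disjoint. Then $H$ is the transitive closure of a rooted tree, and $S$ is the set of leaves of that tree.
   Context: Given a tree $T$ with a root $r$, the transitive closure of $T$ is the graph obtained from $T$ by adding an edge between every vertex $v$ and every descendant of $v$ (with respect to the root $r$). $N(x)$ denotes the set of neighbours of $x$ in $H$. -}

module Defs where

open import Data.Nat using (ℕ)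
open import Data.Fin using (Fin)
open import Data.Bool using (Bool; true; false)
open import Data.Product using (Σ; _×_; ∃)
open import Data.Sum using (_⊎_)
open import Data.Empty using (⊥)
open import Relation.Nullary using (¬_)
open import Relation.Binary.PropositionalEquality using (_≡_; _≢_)
open import Function.Bundles using (_⇔_)

record Graph (n : ℕ) : Set where
  field
    adj   : Fin n → Fin n → Bool
    sym   : ∀ u v → adj u v ≡ adj v u
    irrefl : ∀ v → adj v v ≡ false
open Graph public

_∼[_]_ : ∀ {n} → Fin n → Graph n → Fin n → Set
u ∼[ G ] v = adj G u v ≡ true

data Reach {n} (G : Graph n) : Fin n → Fin n → Set where
  here : ∀ {u} → Reach G u u
  step : ∀ {u v w} → u ∼[ G ] v → Reach G v w → Reach G u w

Connected : ∀ {n} → Graph n → Set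
Connected {n} G = Fin n × (∀ u v → Reach G u v)

VSet : ℕ → Set
VSet n = Fin n → Bool

_∈ˢ_ : ∀ {n} → Fin n → VSet n → Set
v ∈ˢ S = S v ≡ true

_∉ˢ_ : ∀ {n} → Fin n → VSet n → Set
v ∉ˢ S = S v ≡ false

Stable : ∀ {n} → Graph n → VSet n → Set
Stable G S = ∀ s t → s ∈ˢ S → t ∈ˢ S → ¬ (s ∼[ G ] t)

NS⊆ : ∀ {n} → Graph n → VSet n → Fin n → Fin n → Set
NS⊆ G S x y = ∀ s → s ∈ˢ S → x ∼[ G ] s → y ∼[ G ] s

NSDisjoint : ∀ {n} → Graph n → VSet n → Fin n → Fin n → Set
NSDisjoint G S x y = ∀ s → s ∈ˢ S → x ∼[ G ] s → y ∼[ G ] s → ⊥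

-- Rooted trees on the vertex set Fin n, given by a root and parent pointers.
-- Proper-ancestor relation: Anc root parent u v means u is a proper ancestor of v
-- (v is a proper descendant of u).
data Anc {n} (root : Fin n) (parent : Fin n → Fin n) : Fin n → Fin n → Set where
  par  : ∀ {v} → v ≢ root → Anc root parent (parent v) v
  up   : ∀ {u v} → v ≢ root → Anc root parent u (parent v) → Anc root parent u v

-- Every non-root vertex reaches the root by following parent pointers; the tree
-- edges are {v , parent v} for v ≠ root.
record RootedTree (n : ℕ) : Set where
  field
    root        : Fin n
    parent      : Fin n → Fin n
    reachesRoot : ∀ v → v ≢ root → Anc root parent root v
open RootedTree public

Ancestor : ∀ {n} → RootedTree n → Fin n → Fin n → Set
Ancestor T u v = Anc (root T) (parent T) u v

Child : ∀ {n} → RootedTree n → Fin n → Fin n → Set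
Child T u v = u ≢ root T × parent T u ≡ v

Leaf : ∀ {n} → RootedTree n → Fin n → Set
Leaf T v = ∀ u → ¬ Child T u v

IsTransitiveClosure : ∀ {n} → Graph n → RootedTree n → Set
IsTransitiveClosure G T = ∀ u v → (u ∼[ G ] v) ⇔ (Ancestor T u v ⊎ Ancestor T v u)

{-# OPTIONS --safe #-}
-- Rank the vertices by |N(x) ∩ S|, ties broken by index, and say u is above v when they are
-- adjacent and u has the larger rank.  If u is above an X-vertex w then (b) together with the
-- counts forces N(w) ∩ S ⊆ N(u) ∩ S, so every vertex above w is adjacent to one S-vertex s in the
-- closed neighbourhood of w; by (c) any two vertices above w are adjacent, and "above" is
-- transitive.  Connectivity then puts the vertex of largest rank above all others, and making the
-- lowest-ranked vertex above v the parent of v yields a tree whose ancestor relation is "above".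
-- By (a), exactly the X-vertices have something below them, so S is the set of leaves.
module Submission where

open import Defs
open import Data.Bool using (true; false; _∧_) renaming (_≟_ to _≟ᵇ_)
open import Data.Empty using (⊥-elim)
open import Data.Fin using (Fin; toℕ)
open import Data.Fin.Properties using (toℕ<n; toℕ-injective; any?) renaming (_≟_ to _≟ᶠ_)
open import Data.Fin.Subset using (Subset; _∈_; _∉_; _⊆_; ∣_∣)
open import Data.Fin.Subset.Properties using (_∈?_; p⊂q⇒∣p∣<∣q∣)
open import Data.List using (allFin)
open import Data.Vec using (tabulate)
open import Data.Vec.Properties using ([]=⇒lookup; lookup⇒[]=; lookup∘tabulate)
open import Data.List.Relation.Unary.All using () renaming (lookup to All-lookup)
open import Data.List.Membership.Propositional.Properties using (∈-allFin)
open import Data.Nat using (ℕ; suc; _+_; _*_; _∸_; _≤_; _<_; _<?_)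
open import Data.Nat.Induction using (<-wellFounded)
open import Data.Nat.Properties
  using (≤-totalOrder; +-monoʳ-<; +-comm; *-monoˡ-≤; m≤m+n; <-cmp; <-irrefl; <-asym; <-trans;
         +-cancelˡ-≡; ≮⇒≥; <⇒≱; <⇒≤; ≤∧≢⇒<; ∸-monoʳ-<; module ≤-Reasoning)
open import Data.List.Extrema ≤-totalOrder using (argmax; f[xs]≤f[argmax])
open import Data.Product using (Σ; _×_; ∃; _,_; proj₁; proj₂)
open import Data.Sum using (_⊎_; inj₁; inj₂; [_,_]; [_,_]′)
open import Function using (_∘_; id; flip)
open import Function.Bundles using (_⇔_; mk⇔; Equivalence)
open import Induction.WellFounded using (Acc; acc)
open import Relation.Binary.Definitions using (tri<; tri≈; tri>)
open import Relation.Binary.PropositionalEquality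
  using (_≡_; _≢_; refl; trans; subst) renaming (sym to ≡-sym)
open import Relation.Nullary using (¬_; yes; no; contradiction)
open import Relation.Nullary.Decidable using (_×-dec_; decidable-stable)
open import Relation.Unary using (Pred; Decidable)

∧≡true⁺ : ∀ {a b} → a ≡ true → b ≡ true → a ∧ b ≡ true
∧≡true⁺ refl refl = refl

∧≡true⁻ : ∀ a b → a ∧ b ≡ true → a ≡ true × b ≡ true
∧≡true⁻ true true refl = refl , refl

least-by : ∀ {n p} {P : Pred (Fin n) p} (f : Fin n → ℕ) → Decidable P →
           ∀ {v} → P v → ∃ λ u → P u × ∀ {w} → P w → f u ≤ f w
least-by {P = P} f P? {v} = go (<-wellFounded (f v))
  where
  go : ∀ {v} → Acc _<_ (f v) → P v → ∃ λ u → P u × ∀ {w} → P w → f u ≤ f w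
  go {v} (acc rec) pv with any? (λ w → P? w ×-dec f w <? f v)
  ... | yes (w , pw , fw<fv) = go (rec fw<fv) pw
  ... | no ∄smaller = v , pv , λ pw → ≮⇒≥ (λ fw<fv → ∄smaller (_ , pw , fw<fv))

p⊆q∧∣q∣≤∣p∣⇒q⊆p : ∀ {n} {p q : Subset n} → p ⊆ q → ∣ q ∣ ≤ ∣ p ∣ → q ⊆ p
p⊆q∧∣q∣≤∣p∣⇒q⊆p {p = p} p⊆q ∣q∣≤∣p∣ {x} x∈q with x ∈? p
... | yes x∈p = x∈p
... | no x∉p = contradiction ∣q∣≤∣p∣ (<⇒≱ (p⊂q⇒∣p∣<∣q∣ (p⊆q , x , x∈q , x∉p)))

lex-< : ∀ {n a b} (i j : Fin n) → a < b → a * n + toℕ i < b * n + toℕ j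
lex-< {n} {a} {b} i j a<b = begin-strict
  a * n + toℕ i <⟨ +-monoʳ-< (a * n) (toℕ<n i) ⟩
  a * n + n     ≡⟨ +-comm (a * n) n ⟩
  suc a * n     ≤⟨ *-monoˡ-≤ n a<b ⟩
  b * n         ≤⟨ m≤m+n (b * n) (toℕ j) ⟩
  b * n + toℕ j ∎
  where open ≤-Reasoning

lex-injective : ∀ {n a b} (i j : Fin n) → a * n + toℕ i ≡ b * n + toℕ j → i ≡ j
lex-injective {n} {a} {b} i j eq with <-cmp a b
... | tri< a<b _ _ = ⊥-elim (<-irrefl eq (lex-< i j a<b))
... | tri> _ _ b<a = ⊥-elim (<-irrefl (≡-sym eq) (lex-< j i b<a))
... | tri≈ _ refl _ = toℕ-injective (+-cancelˡ-≡ (a * n) _ _ eq)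

Reach-closed : ∀ {n p} (G : Graph n) (P : Fin n → Set p) →
               (∀ {v w} → P v → v ∼[ G ] w → P w) →
               ∀ {u w} → Reach G u w → P u → P w
Reach-closed G P closed here pu = pu
Reach-closed G P closed (step u∼v v⇝w) pu = Reach-closed G P closed v⇝w (closed pu u∼v)

∼-sym : ∀ {n} (G : Graph n) {u v} → u ∼[ G ] v → v ∼[ G ] u
∼-sym G {u} {v} u∼v = trans (Graph.sym G v u) u∼v

∼⇒≢ : ∀ {n} (G : Graph n) {u v} → u ∼[ G ] v → u ≢ v
∼⇒≢ G {u} u∼u refl = contradiction (trans (≡-sym u∼u) (irrefl G u)) λ ()

∉ˢ⇒¬∈ˢ : ∀ {n} {S : VSet n} {v} → v ∉ˢ S → ¬ v ∈ˢ S
∉ˢ⇒¬∈ˢ v∉S v∈S = contradiction (trans (≡-sym v∈S) v∉S) λ ()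

∈ˢ-or-∉ˢ : ∀ {n} (S : VSet n) v → v ∈ˢ S ⊎ v ∉ˢ S
∈ˢ-or-∉ˢ S v with S v
... | true  = inj₁ refl
... | false = inj₂ refl

ancestor⇒¬leaf : ∀ {n} (T : RootedTree n) {u v} → Ancestor T u v → ¬ Leaf T u
ancestor⇒¬leaf T (par v≢root) leaf = leaf _ (v≢root , refl)
ancestor⇒¬leaf T (up _ u<v) = ancestor⇒¬leaf T u<v

module Construction {n : ℕ} (H : Graph n) (S : VSet n)
  (connected : Connected H) (stable : Stable H S)
  (has-S-neighbour : ∀ x → x ∉ˢ S → ∃ λ s → s ∈ˢ S × x ∼[ H ] s)
  (adjacent⇔nested : ∀ x₁ x₂ → x₁ ∉ˢ S → x₂ ∉ˢ S → x₁ ≢ x₂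
    → (x₁ ∼[ H ] x₂) ⇔ (NS⊆ H S x₁ x₂ ⊎ NS⊆ H S x₂ x₁))
  (nonadjacent⇔disjoint : ∀ x₁ x₂ → x₁ ∉ˢ S → x₂ ∉ˢ S → x₁ ≢ x₂
    → (¬ (x₁ ∼[ H ] x₂)) ⇔ NSDisjoint H S x₁ x₂) where

  NS : Fin n → Subset n
  NS x = tabulate λ s → S s ∧ adj H x s

  ∈NS⁺ : ∀ {x s} → s ∈ˢ S → x ∼[ H ] s → s ∈ NS x
  ∈NS⁺ {x} {s} s∈S x∼s = lookup⇒[]= s (NS x) (trans (lookup∘tabulate _ s) (∧≡true⁺ s∈S x∼s))

  ∈NS⁻ : ∀ {x s} → s ∈ NS x → s ∈ˢ S × x ∼[ H ] s
  ∈NS⁻ {x} {s} s∈NSx =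
    ∧≡true⁻ (S s) (adj H x s) (trans (≡-sym (lookup∘tabulate _ s)) ([]=⇒lookup s∈NSx))

  NS⊆⇒⊆ : ∀ {x y} → NS⊆ H S x y → NS x ⊆ NS y
  NS⊆⇒⊆ x⊆y s∈NSx = let s∈S , x∼s = ∈NS⁻ s∈NSx in ∈NS⁺ s∈S (x⊆y _ s∈S x∼s)

  ⊆⇒NS⊆ : ∀ {x y} → NS x ⊆ NS y → NS⊆ H S x y
  ⊆⇒NS⊆ x⊆y s s∈S x∼s = proj₂ (∈NS⁻ (x⊆y (∈NS⁺ s∈S x∼s)))

  ∈ˢ⇒NS-empty : ∀ {x s} → x ∈ˢ S → s ∉ NS x
  ∈ˢ⇒NS-empty {x} x∈S s∈NSx = let s∈S , x∼s = ∈NS⁻ s∈NSx in stable x _ x∈S s∈S x∼s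

  ∼S⇒∉ˢ : ∀ {x s} → x ∼[ H ] s → s ∈ˢ S → x ∉ˢ S
  ∼S⇒∉ˢ {x} {s} x∼s s∈S with ∈ˢ-or-∉ˢ S x
  ... | inj₁ x∈S = ⊥-elim (stable x s x∈S s∈S x∼s)
  ... | inj₂ x∉S = x∉S

  common-S-neighbour⇒∼ : ∀ {x y s} → x ∉ˢ S → y ∉ˢ S → x ≢ y →
                         s ∈ˢ S → x ∼[ H ] s → y ∼[ H ] s → x ∼[ H ] y
  common-S-neighbour⇒∼ {x} {y} {s} x∉S y∉S x≢y s∈S x∼s y∼s =
    decidable-stable (adj H x y ≟ᵇ true)
      λ x≁y → Equivalence.to (nonadjacent⇔disjoint x y x∉S y∉S x≢y) x≁y s s∈S x∼s y∼s

  -- Lexicographic in (|N(x) ∩ S| , x), since toℕ x < n.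
  rank : Fin n → ℕ
  rank x = ∣ NS x ∣ * n + toℕ x

  rank-injective : ∀ {x y} → rank x ≡ rank y → x ≡ y
  rank-injective {x} {y} = lex-injective {a = ∣ NS x ∣} {b = ∣ NS y ∣} x y

  rank<⇒≢ : ∀ {x y} → rank x < rank y → y ≢ x
  rank<⇒≢ x<y refl = <-irrefl refl x<y

  rank-trichotomy : ∀ {x y} → x ≢ y → rank x < rank y ⊎ rank y < rank x
  rank-trichotomy {x} {y} x≢y with <-cmp (rank x) (rank y)
  ... | tri< x<y _ _ = inj₁ x<y
  ... | tri≈ _ x≈y _ = contradiction (rank-injective x≈y) x≢y
  ... | tri> _ _ y<x = inj₂ y<x

  rank<⇒∣NS∣≤ : ∀ {x y} → rank x < rank y → ∣ NS x ∣ ≤ ∣ NS y ∣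
  rank<⇒∣NS∣≤ {x} {y} x<y = ≮⇒≥ λ ∣y∣<∣x∣ → <-asym x<y (lex-< y x ∣y∣<∣x∣)

  rank-∈ˢ<∉ˢ : ∀ {x y} → x ∈ˢ S → y ∉ˢ S → rank x < rank y
  rank-∈ˢ<∉ˢ {x} {y} x∈S y∉S with has-S-neighbour y y∉S
  ... | s , s∈S , y∼s =
    lex-< x y (p⊂q⇒∣p∣<∣q∣ (NSx⊆NSy , s , ∈NS⁺ s∈S y∼s , ∈ˢ⇒NS-empty x∈S))
    where
    NSx⊆NSy : NS x ⊆ NS y
    NSx⊆NSy s∈NSx = contradiction s∈NSx (∈ˢ⇒NS-empty x∈S)

  Above : Fin n → Fin n → Set
  Above u v = u ∼[ H ] v × rank v < rank u

  above? : ∀ v → Decidable (λ u → Above u v)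
  above? v u = (adj H u v ≟ᵇ true) ×-dec (rank v <? rank u)

  above⇒∉ˢ : ∀ {u v} → Above u v → u ∉ˢ S
  above⇒∉ˢ {u} {v} (u∼v , v<u) with ∈ˢ-or-∉ˢ S u | ∈ˢ-or-∉ˢ S v
  ... | inj₂ u∉S | _        = u∉S
  ... | inj₁ u∈S | inj₁ v∈S = ⊥-elim (stable u v u∈S v∈S u∼v)
  ... | inj₁ u∈S | inj₂ v∉S = ⊥-elim (<-asym v<u (rank-∈ˢ<∉ˢ u∈S v∉S))

  above-∉ˢ⇒NS⊆ : ∀ {u w} → w ∉ˢ S → Above u w → NS⊆ H S w u
  above-∉ˢ⇒NS⊆ {u} {w} w∉S u>w@(u∼w , w<u)
    with Equivalence.to (adjacent⇔nested w u w∉S (above⇒∉ˢ u>w) (∼⇒≢ H (∼-sym H u∼w))) (∼-sym H u∼w)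
  ... | inj₁ w⊆u = w⊆u
  ... | inj₂ u⊆w = ⊆⇒NS⊆ (p⊆q∧∣q∣≤∣p∣⇒q⊆p (NS⊆⇒⊆ u⊆w) (rank<⇒∣NS∣≤ w<u))

  _∈N[_] : Fin n → Fin n → Set
  s ∈N[ w ] = w ≡ s ⊎ w ∼[ H ] s

  S-anchor : ∀ w → ∃ λ s → s ∈ˢ S × s ∈N[ w ]
  S-anchor w with ∈ˢ-or-∉ˢ S w
  ... | inj₁ w∈S = w , w∈S , inj₁ refl
  ... | inj₂ w∉S = let s , s∈S , w∼s = has-S-neighbour w w∉S in s , s∈S , inj₂ w∼s

  above-inherits : ∀ {u w s} → Above u w → s ∈ˢ S → s ∈N[ w ] → u ∼[ H ] s
  above-inherits u>w s∈S (inj₁ refl) = proj₁ u>w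
  above-inherits u>w s∈S (inj₂ w∼s)  = above-∉ˢ⇒NS⊆ (∼S⇒∉ˢ w∼s s∈S) u>w _ s∈S w∼s

  ∼-through-anchor : ∀ {u w s} → u ∉ˢ S → u ≢ w →
                     s ∈ˢ S → u ∼[ H ] s → s ∈N[ w ] → u ∼[ H ] w
  ∼-through-anchor u∉S u≢w s∈S u∼s (inj₁ refl) = u∼s
  ∼-through-anchor u∉S u≢w s∈S u∼s (inj₂ w∼s)  =
    common-S-neighbour⇒∼ u∉S (∼S⇒∉ˢ w∼s s∈S) u≢w s∈S u∼s w∼s

  above-trans : ∀ {u v w} → Above u v → Above v w → Above u w
  above-trans {w = w} u>v@(_ , v<u) v>w@(_ , w<v) with S-anchor w
  ... | s , s∈S , s∈N[w] = u∼w , w<u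
    where
    w<u = <-trans w<v v<u
    u∼s = above-inherits u>v s∈S (inj₂ (above-inherits v>w s∈S s∈N[w]))
    u∼w = ∼-through-anchor (above⇒∉ˢ u>v) (rank<⇒≢ w<u) s∈S u∼s s∈N[w]

  above-same⇒∼ : ∀ {u v w} → Above u w → Above v w → u ≢ v → u ∼[ H ] v
  above-same⇒∼ {w = w} u>w v>w u≢v with S-anchor w
  ... | s , s∈S , s∈N[w] =
    ∼-through-anchor (above⇒∉ˢ u>w) u≢v s∈S
      (above-inherits u>w s∈S s∈N[w]) (inj₂ (above-inherits v>w s∈S s∈N[w]))

  top : Fin n
  top = argmax rank (proj₁ connected) (allFin n)

  rank≤rank-top : ∀ v → rank v ≤ rank top
  rank≤rank-top v = All-lookup (f[xs]≤f[argmax] (proj₁ connected) (allFin n)) (∈-allFin v)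

  rank<rank-top : ∀ {v} → v ≢ top → rank v < rank top
  rank<rank-top {v} v≢top = ≤∧≢⇒< (rank≤rank-top v) (v≢top ∘ rank-injective)

  -- The vertices equal to or below top are closed under adjacency, hence are all vertices.
  top-or-below : ∀ v → v ≡ top ⊎ Above top v
  top-or-below v =
    Reach-closed H (λ v → v ≡ top ⊎ Above top v) closed (proj₂ connected top v) (inj₁ refl)
    where
    closed : ∀ {v w} → v ≡ top ⊎ Above top v → v ∼[ H ] w → w ≡ top ⊎ Above top w
    closed {v} {w} v≤top v∼w with w ≟ᶠ top
    ... | yes w≡top = inj₁ w≡top
    ... | no w≢top = inj₂ (top∼w v≤top , rank<rank-top w≢top)
      where
      top∼w : v ≡ top ⊎ Above top v → top ∼[ H ] w
      top∼w (inj₁ refl) = v∼w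
      top∼w (inj₂ top>v) with rank-trichotomy (∼⇒≢ H v∼w)
      ... | inj₁ v<w = above-same⇒∼ top>v (∼-sym H v∼w , v<w) (w≢top ∘ ≡-sym)
      ... | inj₂ w<v = proj₁ (above-trans top>v (v∼w , w<v))

  top-above : ∀ v → v ≢ top → Above top v
  top-above v v≢top = [ flip contradiction v≢top , id ]′ (top-or-below v)

  above⇒≢top : ∀ {u v} → Above u v → v ≢ top
  above⇒≢top {u} (_ , v<u) refl = <⇒≱ v<u (rank≤rank-top u)

  lowest-above : ∀ v → v ≢ top → ∃ λ p → Above p v × ∀ {w} → Above w v → rank p ≤ rank w
  lowest-above v v≢top = least-by rank (above? v) (top-above v v≢top)

  parentOf : Fin n → Fin n
  parentOf v with v ≟ᶠ top
  ... | yes _    = top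
  ... | no v≢top = proj₁ (lowest-above v v≢top)

  parentOf-lowest-above : ∀ v → v ≢ top →
                          Above (parentOf v) v × ∀ {w} → Above w v → rank (parentOf v) ≤ rank w
  parentOf-lowest-above v v≢top with v ≟ᶠ top
  ... | yes v≡top = contradiction v≡top v≢top
  ... | no v≢top′ = proj₂ (lowest-above v v≢top′)

  parentOf-above : ∀ v → v ≢ top → Above (parentOf v) v
  parentOf-above v v≢top = proj₁ (parentOf-lowest-above v v≢top)

  above-parentOf : ∀ {u v} → Above u v → u ≢ parentOf v → Above u (parentOf v)
  above-parentOf {u} {v} u>v u≢p =
    above-same⇒∼ u>v p>v u≢p ,
    ≤∧≢⇒< (proj₂ (parentOf-lowest-above v (above⇒≢top u>v)) u>v) (u≢p ∘ ≡-sym ∘ rank-injective)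
    where
    p>v = parentOf-above v (above⇒≢top u>v)

  Anc⇒Above : ∀ {u v} → Anc top parentOf u v → Above u v
  Anc⇒Above (par v≢top)       = parentOf-above _ v≢top
  Anc⇒Above (up v≢top u<p[v]) = above-trans (Anc⇒Above u<p[v]) (parentOf-above _ v≢top)

  Above⇒Anc : ∀ {u v} → Above u v → Anc top parentOf u v
  Above⇒Anc {u} {v} = climb (<-wellFounded (rank u ∸ rank v))
    where
    climb : ∀ {v} → Acc _<_ (rank u ∸ rank v) → Above u v → Anc top parentOf u v
    climb {v} (acc rec) u>v with u ≟ᶠ parentOf v
    ... | yes u≡p = subst (λ x → Anc top parentOf x v) (≡-sym u≡p) (par (above⇒≢top u>v))
    ... | no u≢p = up v≢top (climb (rec (∸-monoʳ-< (proj₂ p>v) (<⇒≤ (proj₂ u>p)))) u>p)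
      where
      v≢top = above⇒≢top u>v
      p>v = parentOf-above v v≢top
      u>p = above-parentOf u>v u≢p

  tree : RootedTree n
  tree = record
    { root        = top
    ; parent      = parentOf
    ; reachesRoot = λ v v≢top → Above⇒Anc (top-above v v≢top)
    }

  transitiveClosure : IsTransitiveClosure H tree
  transitiveClosure u v = mk⇔ ∼⇒ancestor [ proj₁ ∘ Anc⇒Above , ∼-sym H ∘ proj₁ ∘ Anc⇒Above ]
    where
    ∼⇒ancestor : u ∼[ H ] v → Ancestor tree u v ⊎ Ancestor tree v u
    ∼⇒ancestor u∼v with rank-trichotomy (∼⇒≢ H u∼v)
    ... | inj₁ u<v = inj₂ (Above⇒Anc (∼-sym H u∼v , u<v))
    ... | inj₂ v<u = inj₁ (Above⇒Anc (u∼v , v<u))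

  ∈ˢ⇔leaf : ∀ v → v ∈ˢ S ⇔ Leaf tree v
  ∈ˢ⇔leaf v = mk⇔ ∈ˢ⇒leaf leaf⇒∈ˢ
    where
    ∈ˢ⇒leaf : v ∈ˢ S → Leaf tree v
    ∈ˢ⇒leaf v∈S c (c≢top , p[c]≡v) =
      ∉ˢ⇒¬∈ˢ {S = S} (above⇒∉ˢ (subst (λ x → Above x c) p[c]≡v (parentOf-above c c≢top))) v∈S
    leaf⇒∈ˢ : Leaf tree v → v ∈ˢ S
    leaf⇒∈ˢ leaf with ∈ˢ-or-∉ˢ S v
    ... | inj₁ v∈S = v∈S
    ... | inj₂ v∉S =
      let s , s∈S , v∼s = has-S-neighbour v v∉S
      in ⊥-elim (ancestor⇒¬leaf tree (Above⇒Anc (v∼s , rank-∈ˢ<∉ˢ s∈S v∉S)) leaf)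

lemma3p31 : ∀ {n} (H : Graph n) (S : VSet n)
    → Connected H
    → Stable H S
    → (∀ x → x ∉ˢ S → ∃ λ s → s ∈ˢ S × x ∼[ H ] s)
    → (∀ x₁ x₂ → x₁ ∉ˢ S → x₂ ∉ˢ S → x₁ ≢ x₂
        → (x₁ ∼[ H ] x₂) ⇔ (NS⊆ H S x₁ x₂ ⊎ NS⊆ H S x₂ x₁))
    → (∀ x₁ x₂ → x₁ ∉ˢ S → x₂ ∉ˢ S → x₁ ≢ x₂
        → (¬ (x₁ ∼[ H ] x₂)) ⇔ NSDisjoint H S x₁ x₂)
    → Σ (RootedTree n) λ T → IsTransitiveClosure H T × (∀ v → v ∈ˢ S ⇔ Leaf T v)
lemma3p31 H S connected stable has-S-neighbour adjacent⇔nested nonadjacent⇔disjoint =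
  tree , transitiveClosure , ∈ˢ⇔leaf
  where
  open Construction H S connected stable has-S-neighbour adjacent⇔nested nonadjacent⇔disjoint
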